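{- Let $k_\mathcal{G}=n_\mathcal{G}-1\ge1$. Then $e_{gg'}\in I_\mathcal{G}\subseteq I_{\mathrm{viz}}$ for all 2-element subsets $\{g,g'\}\subseteq D_\mathcal{G}$.
   Context: $\mathbb{K}$ is a subfield of $\mathbb{R}$. $V(\mathcal{G})$ is a set of $n_\mathcal{G}$ vertices with fixed subset $D_\mathcal{G}$ of size $k_\mathcal{G}$; $V(\mathcal{H})$ a disjoint set of $n_\mathcal{H}\ge1$ vertices with fixed subset $D_\mathcal{H}$ of size $1\le k_\mathcal{H}\le n_\mathcal{H}$. Variables $e_{gg'}=e_{g'g}$ for 2-subsets of $V(\mathcal{G})$, $e_{hh'}$ for 2-subsets of $V(\mathcal{H})$, $x_{gh}$ for $g\in V(\mathcal{G}),h\in V(\mathcal{H})$. $I_\mathcal{G}\subseteq\mathbb{K}[e_{gg'}]$ is generated by $e_{gg'}^2-e_{gg'}$ (all $\{g,g'\}$), $\prod_{g'\in D_\mathcal{G}}(1-e_{gg'})$ ($g\in V(\mathcal{G})\setminus D_\mathcal{G}$), and $\prod_{g'\in V(\mathcal{G})\setminus S}\sum_{g\in S}e_{gg'}$ ($S\subseteq V(\mathcal{G})$, $|S|=k_\mathcal{G}-1$); $I_\mathcal{H}$ is defined analogously. $I_{\mathrm{viz}}$ is the ideal of the polynomial ring over $\mathbb{K}$ in all variables generated by the generators of $I_\mathcal{G}$, of $I_\mathcal{H}$, the $x_{gh}^2-x_{gh}$, and $(1-x_{gh})\prod_{g'\ne g}(1-e_{gg'}x_{g'h})\prod_{h'\ne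 h}(1-e_{hh'}x_{gh'})$ for all $g,h$. -}

module Defs where

open import Level using (0ℓ)
open import Algebra.Bundles using (CommutativeRing)
open import Data.Nat using (ℕ; zero; suc) renaming (_+_ to _+ℕ_)
open import Relation.Binary.PropositionalEquality using (_≡_)
open import Data.Fin using (Fin; _≟_) renaming (_<_ to _<F_)
open import Data.Fin.Properties using (<-cmp)
open import Data.Fin.Subset using (Subset; _∈_; _∉_; ∣_∣)
open import Data.Fin.Subset.Properties using (_∈?_)
open import Data.List using (List; filter; foldr; allFin)
open import Data.Product using (Σ; Σ-syntax; ∃; _×_; _,_; proj₁; proj₂)
open import Data.Sum using (_⊎_; inj₁; inj₂)
open import Function using (_∘_)
open import Relation.Nullary using (¬_; ¬?)
open import Relation.Binary.Structures using (IsStrictTotalOrder)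
open import Relation.Binary.Definitions using (tri<; tri≈; tri>)

-- The coefficient field 𝕂 ⊆ ℝ.
-- ℝ is not available; subfields of ℝ are (up to unique isomorphism)
-- exactly the Archimedean ordered fields, which we define here.

ringFromℕ : (R : CommutativeRing 0ℓ 0ℓ) → ℕ → CommutativeRing.Carrier R
ringFromℕ R zero = CommutativeRing.0# R
ringFromℕ R (suc n) = CommutativeRing._+_ R (CommutativeRing.1# R) (ringFromℕ R n)

record ArchimedeanOrderedField : Set₁ where
  field
    commutativeRing : CommutativeRing 0ℓ 0ℓ
  open CommutativeRing commutativeRing public
  field
    _<_ : Carrier → Carrier → Set
    isStrictTotalOrder : IsStrictTotalOrder _≈_ _<_
    +-mono-< : ∀ {x y} z → x < y → (x + z) < (y + z)
    *-pos : ∀ {x y} → 0# < x → 0# < y → 0# < (x * y)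
    1≉0 : ¬ (1# ≈ 0#)
    inverse : ∀ x → ¬ (x ≈ 0#) → Σ Carrier (λ y → (x * y) ≈ 1#)
    archimedean : ∀ x → Σ ℕ (λ n → x < ringFromℕ commutativeRing n)

-- Polynomial rings 𝕂[X] as the free commutative 𝕂-algebra on X:
-- syntactic expressions modulo the commutative-ring congruence,
-- with constants embedded by a ring homomorphism.

module Poly (K : ArchimedeanOrderedField) where
  open ArchimedeanOrderedField K using (Carrier; _≈_; -_; 0#; 1#)
    renaming (_+_ to _+K_; _*_ to _*K_)

  infixl 6 _⊕_ _⊖_
  infixl 7 _⊗_
  infix 8 ⊝_
  infix 4 _≋_

  data Expr (X : Set) : Set where
    con : Carrier → Expr X
    var : X → Expr X
    _⊕_ : Expr X → Expr X → Expr X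
    _⊗_ : Expr X → Expr X → Expr X
    ⊝_  : Expr X → Expr X

  one : ∀ {X} → Expr X
  one = con 1#

  _⊖_ : ∀ {X} → Expr X → Expr X → Expr X
  p ⊖ q = p ⊕ ⊝ q

  data _≋_ {X : Set} : Expr X → Expr X → Set where
    ≋-refl  : ∀ {p} → p ≋ p
    ≋-sym   : ∀ {p q} → p ≋ q → q ≋ p
    ≋-trans : ∀ {p q r} → p ≋ q → q ≋ r → p ≋ r
    ⊕-cong  : ∀ {p p' q q'} → p ≋ p' → q ≋ q' → p ⊕ q ≋ p' ⊕ q'
    ⊗-cong  : ∀ {p p' q q'} → p ≋ p' → q ≋ q' → p ⊗ q ≋ p' ⊗ q'
    ⊝-cong  : ∀ {p p'} → p ≋ p' → ⊝ p ≋ ⊝ p'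
    ⊕-assoc : ∀ p q r → (p ⊕ q) ⊕ r ≋ p ⊕ (q ⊕ r)
    ⊕-comm  : ∀ p q → p ⊕ q ≋ q ⊕ p
    ⊕-identityˡ : ∀ p → con 0# ⊕ p ≋ p
    ⊝-inverseˡ : ∀ p → (⊝ p) ⊕ p ≋ con 0#
    ⊗-assoc : ∀ p q r → (p ⊗ q) ⊗ r ≋ p ⊗ (q ⊗ r)
    ⊗-comm  : ∀ p q → p ⊗ q ≋ q ⊗ p
    ⊗-identityˡ : ∀ p → con 1# ⊗ p ≋ p
    distribʳ : ∀ p q r → (q ⊕ r) ⊗ p ≋ (q ⊗ p) ⊕ (r ⊗ p)
    con-cong : ∀ {a b} → a ≈ b → con a ≋ con b
    con-+ : ∀ a b → con (a +K b) ≋ con a ⊕ con b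
    con-* : ∀ a b → con (a *K b) ≋ con a ⊗ con b
    con-- : ∀ a → con (- a) ≋ ⊝ con a

  data InIdeal {X : Set} (G : Expr X → Set) : Expr X → Set where
    gen  : ∀ {p} → G p → InIdeal G p
    zer  : InIdeal G (con 0#)
    add  : ∀ {p q} → InIdeal G p → InIdeal G q → InIdeal G (p ⊕ q)
    mul  : ∀ {p} r → InIdeal G p → InIdeal G (r ⊗ p)
    resp : ∀ {p q} → p ≋ q → InIdeal G p → InIdeal G q

  rename : ∀ {X Y} → (X → Y) → Expr X → Expr Y
  rename f (con a) = con a
  rename f (var x) = var (f x)
  rename f (p ⊕ q) = rename f p ⊕ rename f q
  rename f (p ⊗ q) = rename f p ⊗ rename f q
  rename f (⊝ p) = ⊝ rename f p

  prodL : ∀ {A : Set} {X} → List A → (A → Expr X) → Expr X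
  prodL xs f = foldr (λ a acc → f a ⊗ acc) one xs

  sumL : ∀ {A : Set} {X} → List A → (A → Expr X) → Expr X
  sumL xs f = foldr (λ a acc → f a ⊕ acc) (con 0#) xs

  -- Graph variables: e_{gg'} indexed by 2-subsets {g,g'} of Fin n,
  -- represented as pairs (g , g') with g < g'.

  EVar : ℕ → Set
  EVar n = Σ[ p ∈ Fin n × Fin n ] (proj₁ p <F proj₂ p)

  -- e_{gg'} = e_{g'g}; only ever used with g ≢ g'
  -- (the diagonal value 0 is a junk value that is never reached).
  e : ∀ {n} → Fin n → Fin n → Expr (EVar n)
  e g g' with <-cmp g g'
  ... | tri< lt _ _ = var ((g , g') , lt)
  ... | tri≈ _ _ _ = con 0#
  ... | tri> _ _ gt = var ((g' , g) , gt)

  inS : ∀ {n} → Subset n → List (Fin n)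
  inS {n} S = filter (λ g → g ∈? S) (allFin n)

  outS : ∀ {n} → Subset n → List (Fin n)
  outS {n} S = filter (λ g → ¬? (g ∈? S)) (allFin n)

  others : ∀ {n} → Fin n → List (Fin n)
  others {n} g = filter (λ g' → ¬? (g' ≟ g)) (allFin n)

  -- generators of I_𝒢 for a graph on Fin n with distinguished set D,
  -- k = ∣ D ∣
  data GenGraph (n : ℕ) (D : Subset n) : Expr (EVar n) → Set where
    boolG : (v : EVar n) → GenGraph n D (var v ⊗ var v ⊖ var v)
    domG  : (g : Fin n) → g ∉ D →
            GenGraph n D (prodL (inS D) (λ g' → one ⊖ e g g'))
    covG  : (S : Subset n) → ∣ S ∣ +ℕ 1 ≡ ∣ D ∣ →
            GenGraph n D (prodL (outS S) (λ g' → sumL (inS S) (λ g → e g g')))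

  VizVar : ℕ → ℕ → Set
  VizVar nG nH = EVar nG ⊎ (EVar nH ⊎ (Fin nG × Fin nH))

  ιG : ∀ {nG nH} → EVar nG → VizVar nG nH
  ιG = inj₁

  ιH : ∀ {nG nH} → EVar nH → VizVar nG nH
  ιH = inj₂ ∘ inj₁

  x : ∀ {nG nH} → Fin nG → Fin nH → Expr (VizVar nG nH)
  x g h = var (inj₂ (inj₂ (g , h)))

  data GenViz (nG : ℕ) (DG : Subset nG) (nH : ℕ) (DH : Subset nH)
       : Expr (VizVar nG nH) → Set where
    fromG : ∀ {p} → GenGraph nG DG p → GenViz nG DG nH DH (rename ιG p)
    fromH : ∀ {p} → GenGraph nH DH p → GenViz nG DG nH DH (rename ιH p)
    boolX : (g : Fin nG) (h : Fin nH) →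
            GenViz nG DG nH DH (x g h ⊗ x g h ⊖ x g h)
    vizG  : (g : Fin nG) (h : Fin nH) →
            GenViz nG DG nH DH
              ((one ⊖ x g h)
               ⊗ prodL (others g) (λ g' → one ⊖ rename ιG (e g g') ⊗ x g' h)
               ⊗ prodL (others h) (λ h' → one ⊖ rename ιH (e h h') ⊗ x g h'))

module Submission where

-- Let u be the unique vertex outside D = D_𝒢.  The domination generator
-- of u says ∏_{d ∈ D} (1 - e_{ud}) ∈ I_𝒢, so e_{gg'} ∈ I_𝒢 as soon as
-- e_{gg'} e_{ud} ∈ I_𝒢 for every d ∈ D.  For such a d pick a ∈ {g, g'}
-- with a ≠ d and let b be the other endpoint.  The covering generator of
-- S = D ∖ {a} is a product of two sums of edge variables, indexed by the
-- two vertices a and u outside S; the first sum contains e_{ba} and the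
-- second contains e_{du}.  Since edge variables are idempotent modulo
-- I_𝒢, and a constant c > 0 plus a sum of idempotents is invertible over
-- an ordered field, both factors can be cancelled from the multiple
-- e_{ab} e_{du} of the generator, leaving e_{ab} e_{du} ∈ I_𝒢.

open import Defs
open import Data.Nat using (ℕ; _≤_; _∸_)
open import Data.Fin.Subset using (Subset; _∈_; ∣_∣)
open import Data.Product using (_×_; proj₁; proj₂; _,_)
open import Data.Sum using (inj₁)
open import Relation.Binary.PropositionalEquality using (_≡_)

open import Data.Nat using (zero; suc)
open import Level using (0ℓ)
open import Algebra.Bundles using (CommutativeRing)

-- The canonical map ℤ → R is a ring morphism for every commutative ring R;
-- this instantiates the standard ring solver with integer coefficients,
-- which (unlike R-coefficients) normalise by computation.
module IntegerCoefficients (R : CommutativeRing 0ℓ 0ℓ) where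
  import Data.Nat as ℕ
  import Data.Nat.Properties as ℕP
  open import Data.Integer as ℤ using (ℤ; +_; -[1+_]; sign; _⊖_) renaming (∣_∣ to ∣_∣ᶻ)
  import Data.Integer.Properties as ℤP
  open import Data.Sign as Sign using (Sign)
  open import Data.Maybe using (Maybe; just; nothing)
  import Relation.Binary.PropositionalEquality as P
  open import Relation.Nullary using (yes; no)
  open import Algebra.Solver.Ring.AlmostCommutativeRing
    using (AlmostCommutativeRing; fromCommutativeRing; _-Raw-AlmostCommutative⟶_)

  open CommutativeRing R
  open import Algebra.Properties.Ring ring using (-1*x≈-x; -‿involutive; -0#≈0#; -‿+-comm)
  open import Algebra.Properties.Semiring.Mult semiring using (×-homo-+; ×1-homo-*)
    renaming (_×_ to _×ᴺ_)
  open import Algebra.Properties.CommutativeSemigroup +-commutativeSemigroup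
    using () renaming (interchange to +-interchange)
  open import Algebra.Properties.CommutativeSemigroup *-commutativeSemigroup
    using () renaming (interchange to *-interchange)
  open import Relation.Binary.Reasoning.Setoid setoid

  -- n · 1, written so that 1 ↦ 1# holds definitionally
  fromℕ : ℕ → Carrier
  fromℕ zero = 0#
  fromℕ (suc zero) = 1#
  fromℕ (suc (suc n)) = 1# + fromℕ (suc n)

  fromℤ : ℤ → Carrier
  fromℤ (+ n) = fromℕ n
  fromℤ -[1+ n ] = - fromℕ (suc n)

  -- the library's n-fold sum of 1#, which carries the semiring laws
  N : ℕ → Carrier
  N n = n ×ᴺ 1#

  fromℕ≈N : ∀ n → fromℕ n ≈ N n
  fromℕ≈N zero = refl
  fromℕ≈N (suc zero) = sym (+-identityʳ 1#)
  fromℕ≈N (suc (suc n)) = +-congˡ (fromℕ≈N (suc n))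

  signed : Sign → Carrier
  signed Sign.+ = 1#
  signed Sign.- = - 1#

  fromℤ-polar : ∀ z → fromℤ z ≈ signed (sign z) * N ∣ z ∣ᶻ
  fromℤ-polar (+ n) = trans (fromℕ≈N n) (sym (*-identityˡ _))
  fromℤ-polar -[1+ n ] = trans (-‿cong (fromℕ≈N (suc n))) (sym (-1*x≈-x _))

  fromℤ-◃ : ∀ s n → fromℤ (s ℤ.◃ n) ≈ signed s * N n
  fromℤ-◃ s zero = sym (zeroʳ _)
  fromℤ-◃ Sign.+ (suc n) = fromℤ-polar (+ suc n)
  fromℤ-◃ Sign.- (suc n) = fromℤ-polar -[1+ n ]

  signed-* : ∀ s t → signed (s Sign.* t) ≈ signed s * signed t
  signed-* Sign.+ Sign.+ = sym (*-identityˡ _)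
  signed-* Sign.+ Sign.- = sym (*-identityˡ _)
  signed-* Sign.- Sign.+ = sym (*-identityʳ _)
  signed-* Sign.- Sign.- = sym (trans (-1*x≈-x _) (-‿involutive _))

  *-homo : ∀ i j → fromℤ (i ℤ.* j) ≈ fromℤ i * fromℤ j
  *-homo i j = begin
    fromℤ (i ℤ.* j)
      ≈⟨ fromℤ-◃ (sign i Sign.* sign j) (∣ i ∣ᶻ ℕ.* ∣ j ∣ᶻ) ⟩
    signed (sign i Sign.* sign j) * N (∣ i ∣ᶻ ℕ.* ∣ j ∣ᶻ)
      ≈⟨ *-cong (signed-* (sign i) (sign j)) (×1-homo-* ∣ i ∣ᶻ ∣ j ∣ᶻ) ⟩
    (signed (sign i) * signed (sign j)) * (N ∣ i ∣ᶻ * N ∣ j ∣ᶻ)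
      ≈⟨ *-interchange _ _ _ _ ⟩
    (signed (sign i) * N ∣ i ∣ᶻ) * (signed (sign j) * N ∣ j ∣ᶻ)
      ≈⟨ sym (*-cong (fromℤ-polar i) (fromℤ-polar j)) ⟩
    fromℤ i * fromℤ j ∎

  -‿homo : ∀ z → fromℤ (ℤ.- z) ≈ - fromℤ z
  -‿homo (+ zero) = sym -0#≈0#
  -‿homo (+ suc n) = refl
  -‿homo -[1+ n ] = sym (-‿involutive _)

  fromℤ-⊖ : ∀ m n → fromℤ (m ⊖ n) ≈ N m + - N n
  fromℤ-⊖ m zero = begin
    fromℤ (m ⊖ 0) ≈⟨ reflexive (P.cong fromℤ (ℤP.⊖-≥ {m} {0} ℕ.z≤n)) ⟩
    fromℕ m       ≈⟨ fromℕ≈N m ⟩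
    N m           ≈⟨ sym (+-identityʳ _) ⟩
    N m + 0#      ≈⟨ +-congˡ (sym -0#≈0#) ⟩
    N m + - N 0   ∎
  fromℤ-⊖ zero (suc n) = begin
    fromℤ (0 ⊖ suc n) ≈⟨ reflexive (P.cong fromℤ (ℤP.⊖-< {0} {suc n} (ℕ.s≤s ℕ.z≤n))) ⟩
    - fromℕ (suc n)   ≈⟨ -‿cong (fromℕ≈N (suc n)) ⟩
    - N (suc n)       ≈⟨ sym (+-identityˡ _) ⟩
    N 0 + - N (suc n) ∎
  fromℤ-⊖ (suc m) (suc n) = begin
    fromℤ (suc m ⊖ suc n)      ≈⟨ reflexive (P.cong fromℤ (ℤP.[1+m]⊖[1+n]≡m⊖n m n)) ⟩
    fromℤ (m ⊖ n)              ≈⟨ fromℤ-⊖ m n ⟩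
    N m + - N n                ≈⟨ sym (+-identityˡ _) ⟩
    0# + (N m + - N n)         ≈⟨ +-congʳ (sym (-‿inverseʳ 1#)) ⟩
    (1# + - 1#) + (N m + - N n) ≈⟨ +-interchange _ _ _ _ ⟩
    (1# + N m) + (- 1# + - N n) ≈⟨ +-congˡ (-‿+-comm _ _) ⟩
    N (suc m) + - N (suc n)    ∎

  +-homo : ∀ i j → fromℤ (i ℤ.+ j) ≈ fromℤ i + fromℤ j
  +-homo (+ m) (+ n) = begin
    fromℕ (m ℕ.+ n)   ≈⟨ fromℕ≈N (m ℕ.+ n) ⟩
    N (m ℕ.+ n)       ≈⟨ ×-homo-+ 1# m n ⟩
    N m + N n         ≈⟨ sym (+-cong (fromℕ≈N m) (fromℕ≈N n)) ⟩
    fromℕ m + fromℕ n ∎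
  +-homo (+ m) -[1+ n ] = begin
    fromℤ (m ⊖ suc n)             ≈⟨ fromℤ-⊖ m (suc n) ⟩
    N m + - N (suc n)             ≈⟨ sym (+-cong (fromℕ≈N m) (-‿cong (fromℕ≈N (suc n)))) ⟩
    fromℤ (+ m) + fromℤ -[1+ n ] ∎
  +-homo -[1+ m ] (+ n) = begin
    fromℤ (n ⊖ suc m)             ≈⟨ fromℤ-⊖ n (suc m) ⟩
    N n + - N (suc m)             ≈⟨ +-comm _ _ ⟩
    - N (suc m) + N n             ≈⟨ sym (+-cong (-‿cong (fromℕ≈N (suc m))) (fromℕ≈N n)) ⟩
    fromℤ -[1+ m ] + fromℤ (+ n) ∎
  +-homo -[1+ m ] -[1+ n ] = begin
    - fromℕ (suc (suc (m ℕ.+ n))) ≈⟨ -‿cong (fromℕ≈N (suc (suc (m ℕ.+ n)))) ⟩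
    - N (suc (suc (m ℕ.+ n)))     ≈⟨ reflexive (P.cong (λ k → - N (suc k)) (P.sym (ℕP.+-suc m n))) ⟩
    - N (suc m ℕ.+ suc n)         ≈⟨ -‿cong (×-homo-+ 1# (suc m) (suc n)) ⟩
    - (N (suc m) + N (suc n))     ≈⟨ sym (-‿+-comm _ _) ⟩
    - N (suc m) + - N (suc n)     ≈⟨ sym (+-cong (-‿cong (fromℕ≈N (suc m))) (-‿cong (fromℕ≈N (suc n)))) ⟩
    fromℤ -[1+ m ] + fromℤ -[1+ n ] ∎

  almostCommutativeRing : AlmostCommutativeRing 0ℓ 0ℓ
  almostCommutativeRing = fromCommutativeRing R

  fromℤ-morphism : ℤ.+-*-rawRing -Raw-AlmostCommutative⟶ almostCommutativeRing
  fromℤ-morphism = record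
    { ⟦_⟧ = fromℤ ; +-homo = +-homo ; *-homo = *-homo ; -‿homo = -‿homo
    ; 0-homo = refl ; 1-homo = refl }

  coefficient-test : ∀ a b → Maybe (fromℤ a ≈ fromℤ b)
  coefficient-test a b with a ℤ.≟ b
  ... | yes P.refl = just refl
  ... | no _ = nothing

  open import Algebra.Solver.Ring ℤ.+-*-rawRing almostCommutativeRing
    fromℤ-morphism coefficient-test public

module PolynomialRing (K : ArchimedeanOrderedField) (X : Set) where
  open Poly K
  open ArchimedeanOrderedField K using (0#; 1#)
  open import Relation.Binary.Structures using (IsEquivalence)

  ≋-isEquivalence : IsEquivalence (_≋_ {X})
  ≋-isEquivalence = record { refl = ≋-refl ; sym = ≋-sym ; trans = ≋-trans }

  commutativeRing : CommutativeRing 0ℓ 0ℓ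
  commutativeRing = record
    { Carrier = Expr X ; _≈_ = _≋_ ; _+_ = _⊕_ ; _*_ = _⊗_ ; -_ = ⊝_
    ; 0# = con 0# ; 1# = con 1#
    ; isCommutativeRing = record
      { isRing = record
        { +-isAbelianGroup = record
          { isGroup = record
            { isMonoid = record
              { isSemigroup = record
                { isMagma = record { isEquivalence = ≋-isEquivalence ; ∙-cong = ⊕-cong }
                ; assoc = ⊕-assoc }
              ; identity = ⊕-identityˡ , λ p → ≋-trans (⊕-comm p _) (⊕-identityˡ p) }
            ; inverse = ⊝-inverseˡ , λ p → ≋-trans (⊕-comm p _) (⊝-inverseˡ p)
            ; ⁻¹-cong = ⊝-cong }
          ; comm = ⊕-comm }
        ; *-cong = ⊗-cong
        ; *-assoc = ⊗-assoc
        ; *-identity = ⊗-identityˡ , λ p → ≋-trans (⊗-comm p _) (⊗-identityˡ p)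
        ; distrib = (λ p q r → ≋-trans (⊗-comm p _)
                       (≋-trans (distribʳ p q r) (⊕-cong (⊗-comm q p) (⊗-comm r p))))
                  , distribʳ }
      ; *-comm = ⊗-comm } }

  open CommutativeRing commutativeRing public using (*-identityʳ)
  open IntegerCoefficients commutativeRing public
    using (solve; _:=_; _:+_; _:*_; _:-_; :-_) renaming (con to :con)

  open import Data.Integer using (+_)

  :0 :1 : ∀ {k} → IntegerCoefficients.Polynomial commutativeRing k
  :0 = :con (+ 0)
  :1 = :con (+ 1)

module Renaming (K : ArchimedeanOrderedField) where
  open Poly K

  rename-≋ : ∀ {X Y} (f : X → Y) {p q : Expr X} → p ≋ q → rename f p ≋ rename f q
  rename-≋ f ≋-refl = ≋-refl
  rename-≋ f (≋-sym h) = ≋-sym (rename-≋ f h)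
  rename-≋ f (≋-trans h h') = ≋-trans (rename-≋ f h) (rename-≋ f h')
  rename-≋ f (⊕-cong h h') = ⊕-cong (rename-≋ f h) (rename-≋ f h')
  rename-≋ f (⊗-cong h h') = ⊗-cong (rename-≋ f h) (rename-≋ f h')
  rename-≋ f (⊝-cong h) = ⊝-cong (rename-≋ f h)
  rename-≋ f (⊕-assoc p q r) = ⊕-assoc _ _ _
  rename-≋ f (⊕-comm p q) = ⊕-comm _ _
  rename-≋ f (⊕-identityˡ p) = ⊕-identityˡ _
  rename-≋ f (⊝-inverseˡ p) = ⊝-inverseˡ _
  rename-≋ f (⊗-assoc p q r) = ⊗-assoc _ _ _
  rename-≋ f (⊗-comm p q) = ⊗-comm _ _
  rename-≋ f (⊗-identityˡ p) = ⊗-identityˡ _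
  rename-≋ f (distribʳ p q r) = distribʳ _ _ _
  rename-≋ f (con-cong a≈b) = con-cong a≈b
  rename-≋ f (con-+ a b) = con-+ a b
  rename-≋ f (con-* a b) = con-* a b
  rename-≋ f (con-- a) = con-- a

  rename-ideal : ∀ {X Y} (f : X → Y) {G : Expr X → Set} {H : Expr Y → Set} →
                 (∀ {p} → G p → H (rename f p)) →
                 ∀ {p} → InIdeal G p → InIdeal H (rename f p)
  rename-ideal f G⊆H (gen g) = gen (G⊆H g)
  rename-ideal f G⊆H zer = zer
  rename-ideal f G⊆H (add h h') = add (rename-ideal f G⊆H h) (rename-ideal f G⊆H h')
  rename-ideal f G⊆H (mul r h) = mul (rename f r) (rename-ideal f G⊆H h)
  rename-ideal f G⊆H (resp p≋q h) = resp (rename-≋ f p≋q) (rename-ideal f G⊆H h)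

-- Positivity facts in an ordered field, needed to invert c + (idempotents).
module OrderedFieldFacts (K : ArchimedeanOrderedField) where
  open ArchimedeanOrderedField K
  open import Algebra.Properties.Ring ring using (-1*x≈-x; -‿involutive)
  open import Data.Empty using (⊥-elim)
  open import Relation.Nullary using (¬_)
  open import Relation.Binary.Definitions using (tri<; tri≈; tri>)
  open import Relation.Binary.Structures using (IsStrictTotalOrder)
  open IsStrictTotalOrder isStrictTotalOrder using (compare; irrefl; <-respʳ-≈; <-respˡ-≈)
    renaming (trans to <-trans)

  -- if 1 < 0 then 0 < -1, hence 0 < (-1)(-1) = 1, a contradiction
  0<1 : 0# < 1#
  0<1 with compare 0# 1#
  ... | tri< 0<1′ _ _ = 0<1′
  ... | tri≈ _ 0≈1 _ = ⊥-elim (1≉0 (sym 0≈1))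
  ... | tri> _ _ 1<0 = ⊥-elim (irrefl refl (<-trans 0<[-1]² 1<0))
    where
    0<-1 : 0# < (- 1#)
    0<-1 = <-respʳ-≈ (+-identityˡ _) (<-respˡ-≈ (-‿inverseʳ 1#) (+-mono-< (- 1#) 1<0))
    0<[-1]² : 0# < 1#
    0<[-1]² = <-respʳ-≈ (trans (-1*x≈-x _) (-‿involutive _)) (*-pos 0<-1 0<-1)

  positive-+1 : ∀ {c} → 0# < c → 0# < (c + 1#)
  positive-+1 0<c = <-trans (<-respʳ-≈ (sym (+-identityˡ 1#)) 0<1) (+-mono-< 1# 0<c)

  positive⇒≉0 : ∀ {c} → 0# < c → ¬ (c ≈ 0#)
  positive⇒≉0 0<c c≈0 = irrefl (sym c≈0) 0<c

module IdempotentCancellation (K : ArchimedeanOrderedField) (X : Set) (G : Poly.Expr K X → Set) where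
  open Poly K
  open ArchimedeanOrderedField K using (0#; 1#; inverse) renaming (_<_ to _<K_)
  open OrderedFieldFacts K
  open PolynomialRing K X
  open import Data.List using (List; []; _∷_)
  open import Data.List.Membership.Propositional using () renaming (_∈_ to _∈L_)
  open import Data.List.Relation.Unary.Any using (here; there; _─_)
  import Relation.Binary.PropositionalEquality as P

  I : Expr X → Set
  I = InIdeal G

  Fixes : Expr X → Expr X → Set
  Fixes q y = I (q ⊗ y ⊖ q)

  Idempotent : Expr X → Set
  Idempotent y = Fixes y y

  Cancellable : Expr X → Expr X → Set
  Cancellable q y = ∀ r → I ((r ⊗ q) ⊗ y) → I (r ⊗ q)

  fixes-resp : ∀ {q q' y} → q ≋ q' → Fixes q y → Fixes q' y
  fixes-resp q≋q' = resp (⊕-cong (⊗-cong q≋q' ≋-refl) (⊝-cong q≋q'))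

  fixes-multiple : ∀ {q y} r → Fixes q y → Fixes (r ⊗ q) y
  fixes-multiple {q} {y} r h =
    resp (solve 3 (λ R Q Y → R :* (Q :* Y :- Q) := (R :* Q) :* Y :- R :* Q) ≋-refl r q y) (mul r h)

  split-on : ∀ q y → I (q ⊗ y) → I (q ⊗ (one ⊖ y)) → I q
  split-on q y h₁ h₂ = resp (solve 2 (λ Q Y → Q :* Y :+ Q :* (:1 :- Y) := Q) ≋-refl q y) (add h₁ h₂)

  -- c + y₁ + … + yₖ is invertible modulo I when c > 0 and the yᵢ are
  -- idempotent: split q along y₁, which raises c by 1 or drops y₁.
  invertible-sum : ∀ {A : Set} (xs : List A) (f : A → Expr X) → (∀ a → Idempotent (f a)) →
                   ∀ {c} → 0# <K c → ∀ q → I (q ⊗ (con c ⊕ sumL xs f)) → I q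
  invertible-sum [] f idem {c} 0<c q h with inverse c (positive⇒≉0 0<c)
  ... | c⁻¹ , c*c⁻¹≈1 = resp c⁻¹·h≋q (mul (con c⁻¹) h)
    where
    c⁻¹·h≋q : con c⁻¹ ⊗ (q ⊗ (con c ⊕ con 0#)) ≋ q
    c⁻¹·h≋q = ≋-trans
      (solve 4 (λ C⁻¹ Q C Z → C⁻¹ :* (Q :* (C :+ :0)) := (C :* C⁻¹) :* Q) ≋-refl (con c⁻¹) q (con c) (con 0#))
      (≋-trans (⊗-cong (≋-trans (≋-sym (con-* c c⁻¹)) (con-cong c*c⁻¹≈1)) ≋-refl) (⊗-identityˡ q))
  invertible-sum (a ∷ xs) f idem {c} 0<c q h = split-on q y on-y off-y
    where
    y = f a
    R = sumL xs f
    on-y : I (q ⊗ y)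
    on-y = invertible-sum xs f idem (positive-+1 0<c) (q ⊗ y)
      (resp (≋-trans (solve 4 (λ Y Q C R → Y :* (Q :* (C :+ (Y :+ R))) :+ (:- Q) :* (Y :* Y :- Y)
                                         := (Q :* Y) :* ((C :+ :1) :+ R)) ≋-refl y q (con c) R)
                     (⊗-cong ≋-refl (⊕-cong (≋-sym (con-+ c 1#)) ≋-refl)))
        (add (mul y h) (mul (⊝ q) (idem a))))
    off-y : I (q ⊗ (one ⊖ y))
    off-y = invertible-sum xs f idem 0<c (q ⊗ (one ⊖ y))
      (resp (solve 4 (λ Y Q C R → (:1 :- Y) :* (Q :* (C :+ (Y :+ R))) :+ Q :* (Y :* Y :- Y)
                                := (Q :* (:1 :- Y)) :* (C :+ R)) ≋-refl y q (con c) R)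
        (add (mul (one ⊖ y) h) (mul q (idem a))))

  sum-remove : ∀ {A : Set} {xs : List A} (f : A → Expr X) {x₀} (x₀∈xs : x₀ ∈L xs) →
               sumL xs f ≋ f x₀ ⊕ sumL (xs ─ x₀∈xs) f
  sum-remove f (here P.refl) = ≋-refl
  sum-remove f {x₀} (there {x = x} {xs = xs} x₀∈xs) =
    ≋-trans (⊕-cong ≋-refl (sum-remove f x₀∈xs))
      (solve 3 (λ A B C → A :+ (B :+ C) := B :+ (A :+ C)) ≋-refl (f x) (f x₀) (sumL (xs ─ x₀∈xs) f))

  -- a sum of idempotents one of whose terms fixes q can be cancelled
  -- from q: modulo I, q Σ y ≡ q (1 + Σ_{rest} y), which is invertible
  sum-cancellable : ∀ {A : Set} (xs : List A) (f : A → Expr X) → (∀ a → Idempotent (f a)) →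
                    ∀ {x₀} → x₀ ∈L xs → ∀ {q} → Fixes q (f x₀) → Cancellable q (sumL xs f)
  sum-cancellable xs f idem {x₀} x₀∈xs {q} fixes r h =
    invertible-sum (xs ─ x₀∈xs) f idem 0<1 (r ⊗ q)
      (resp (solve 3 (λ Q Y R → Q :* (Y :+ R) :+ (:- :1) :* (Q :* Y :- Q) := Q :* (:1 :+ R))
               ≋-refl (r ⊗ q) (f x₀) (sumL (xs ─ x₀∈xs) f))
        (add (resp (⊗-cong ≋-refl (sum-remove f x₀∈xs)) h) (mul (⊝ one) (fixes-multiple r fixes))))

  product-cancel : ∀ {A : Set} (xs : List A) (F : A → Expr X) q →
                   (∀ x → x ∈L xs → Cancellable q (F x)) → I (q ⊗ prodL xs F) → I q
  product-cancel [] F q cancel h = resp (*-identityʳ q) h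
  product-cancel (x ∷ xs) F q cancel h =
    product-cancel xs F q (λ z z∈xs → cancel z (there z∈xs))
      (resp (⊗-comm _ _)
        (cancel x (here P.refl) (prodL xs F)
          (resp (solve 3 (λ Q Fx Pr → Q :* (Fx :* Pr) := (Pr :* Q) :* Fx) ≋-refl q (F x) (prodL xs F)) h)))

  annihilate : ∀ {A : Set} (xs : List A) (y : A → Expr X) q →
               (∀ d → d ∈L xs → I (q ⊗ y d)) → I (q ⊗ prodL xs (λ d → one ⊖ y d)) → I q
  annihilate [] y q kills h = resp (*-identityʳ q) h
  annihilate (d ∷ xs) y q kills h =
    annihilate xs y q (λ d' d'∈xs → kills d' (there d'∈xs))
      (resp (solve 3 (λ Q Y Pr → Q :* ((:1 :- Y) :* Pr) :+ Pr :* (Q :* Y) := Q :* Pr)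
               ≋-refl q (y d) (prodL xs (λ d' → one ⊖ y d')))
        (add h (mul (prodL xs (λ d' → one ⊖ y d')) (kills d (here P.refl)))))

module AlmostFullSubset where
  import Data.Nat.Properties as ℕP
  open import Data.Fin using (Fin; _≟_)
  open import Data.Fin.Subset using (_∉_; _-_; ⊤; ∁; _⊂_; inside; outside) renaming (⊥ to ∅)
  open import Data.Fin.Subset.Properties
    using (_∈?_; p─⊥≡p; x∈p∧x≢y⇒x∈p-y; ∈⊤; ∣⊤∣≡n; p⊂q⇒∣p∣<∣q∣; x∈p⇒∣p-x∣<∣p∣;
           ∣∁p∣≡n∸∣p∣; nonempty?; Empty-unique; ∣⊥∣≡0; x∈∁p⇒x∉p)
  open import Data.Vec using (_∷_)
  open import Data.Vec.Base using (here; there)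
  open import Data.Sum using (_⊎_; inj₂)
  open import Data.Product using (∃)
  open import Data.Empty using (⊥-elim)
  open import Relation.Nullary using (yes; no)
  open import Relation.Binary.PropositionalEquality using (_≢_; cong; sym; subst; module ≡-Reasoning)

  ∣p-x∣+1≡∣p∣ : ∀ {n} {x : Fin n} {p : Subset n} → x ∈ p → suc ∣ p - x ∣ ≡ ∣ p ∣
  ∣p-x∣+1≡∣p∣ {p = inside ∷ p} here = cong (λ q → suc ∣ q ∣) (p─⊥≡p p)
  ∣p-x∣+1≡∣p∣ {p = inside ∷ p} (there x∈p) = cong suc (∣p-x∣+1≡∣p∣ x∈p)
  ∣p-x∣+1≡∣p∣ {p = outside ∷ p} (there x∈p) = ∣p-x∣+1≡∣p∣ x∈p

  ∉-remove : ∀ {n} {x a : Fin n} (p : Subset n) → x ∉ p - a → x ∉ p ⊎ x ≡ a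
  ∉-remove {x = x} {a} p x∉p-a with x ≟ a | x ∈? p
  ... | yes x≡a | _ = inj₂ x≡a
  ... | no x≢a | yes x∈p = ⊥-elim (x∉p-a (x∈p∧x≢y⇒x∈p-y x∈p x≢a))
  ... | no _ | no x∉p = inj₁ x∉p

  module _ {m : ℕ} (D : Subset (suc m)) (∣D∣≡m : ∣ D ∣ ≡ m) where

    -- ∁ D has 1 + m - m = 1 element, so it is nonempty
    missing-exists : ∃ λ u → u ∉ D
    missing-exists with nonempty? (∁ D)
    ... | yes (u , u∈∁D) = u , x∈∁p⇒x∉p u∈∁D
    ... | no empty = ⊥-elim (1≢0 (begin
          1                  ≡⟨ sym (ℕP.m+n∸n≡m 1 m) ⟩
          suc m ∸ m          ≡⟨ cong (suc m ∸_) (sym ∣D∣≡m) ⟩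
          suc m ∸ ∣ D ∣      ≡⟨ sym (∣∁p∣≡n∸∣p∣ D) ⟩
          ∣ ∁ D ∣            ≡⟨ cong ∣_∣ (Empty-unique empty) ⟩
          ∣ ∅ {suc m} ∣      ≡⟨ ∣⊥∣≡0 (suc m) ⟩
          0                  ∎))
      where
      open ≡-Reasoning
      1≢0 : 1 ≢ 0
      1≢0 ()

    -- two distinct missing points x ≠ u would give D ⊂ ⊤ - u ⊂ ⊤,
    -- i.e. m + 2 ≤ m + 1
    missing-unique : ∀ {x u} → x ∉ D → u ∉ D → x ≡ u
    missing-unique {x} {u} x∉D u∉D with x ≟ u
    ... | yes x≡u = x≡u
    ... | no x≢u = ⊥-elim (ℕP.n≮n (suc m) (begin-strict
          suc m          ≡⟨ cong suc (sym ∣D∣≡m) ⟩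
          suc ∣ D ∣      ≤⟨ p⊂q⇒∣p∣<∣q∣ D⊂⊤-u ⟩
          ∣ ⊤ {suc m} - u ∣ <⟨ x∈p⇒∣p-x∣<∣p∣ (∈⊤ {x = u}) ⟩
          ∣ ⊤ {suc m} ∣  ≡⟨ ∣⊤∣≡n (suc m) ⟩
          suc m          ∎))
      where
      open ℕP.≤-Reasoning
      D⊂⊤-u : D ⊂ ⊤ {suc m} - u
      D⊂⊤-u = (λ {y} y∈D → x∈p∧x≢y⇒x∈p-y ∈⊤ (λ y≡u → u∉D (subst (_∈ D) y≡u y∈D)))
            , x , x∈p∧x≢y⇒x∈p-y ∈⊤ x≢u , x∉D

module EdgeVariables (K : ArchimedeanOrderedField) {n : ℕ} (D : Subset n) where
  open Poly K
  open PolynomialRing K (EVar n) using (solve; _:=_; _:*_; _:-_; :0)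
  open IdempotentCancellation K (EVar n) (GenGraph n D)
  open import Data.Nat using () renaming (_+_ to _+ℕ_)
  import Data.Nat.Properties as ℕP
  open import Data.Fin using (Fin; _≟_) renaming (_<_ to _<F_)
  open import Data.Fin.Properties using (<-cmp; <-irrelevant; <⇒≢)
  open import Data.Fin.Subset using (_∉_; _-_)
  open import Data.Fin.Subset.Properties using (_∈?_; x∈p∧x≢y⇒x∈p-y)
  open import Data.List using (allFin)
  open import Data.List.Membership.Propositional using () renaming (_∈_ to _∈L_)
  open import Data.List.Membership.Propositional.Properties using (∈-filter⁺; ∈-filter⁻; ∈-allFin)
  open import Data.Sum using (inj₂)
  open import Data.Empty using (⊥-elim)
  open import Relation.Nullary using (¬?; yes; no)
  open import Relation.Binary.Definitions using (tri<; tri≈; tri>)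
  open import Relation.Binary.PropositionalEquality using (_≢_; refl; cong; sym; trans; subst)
  open AlmostFullSubset

  e-ordered : ∀ {a b : Fin n} (a<b : a <F b) → e a b ≡ var ((a , b) , a<b)
  e-ordered {a} {b} a<b with <-cmp a b
  ... | tri< a<b′ _ _ = cong (λ lt → var ((a , b) , lt)) (<-irrelevant a<b′ a<b)
  ... | tri≈ a≮b _ _ = ⊥-elim (a≮b a<b)
  ... | tri> a≮b _ _ = ⊥-elim (a≮b a<b)

  e-reversed : ∀ {a b : Fin n} (b<a : b <F a) → e a b ≡ var ((b , a) , b<a)
  e-reversed {a} {b} b<a with <-cmp a b
  ... | tri< _ _ b≮a = ⊥-elim (b≮a b<a)
  ... | tri≈ _ _ b≮a = ⊥-elim (b≮a b<a)
  ... | tri> _ _ b<a′ = cong (λ lt → var ((b , a) , lt)) (<-irrelevant b<a′ b<a)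

  e-sym : ∀ (a b : Fin n) → e a b ≡ e b a
  e-sym a b with a ≟ b
  ... | yes refl = refl
  ... | no a≢b with <-cmp a b
  ...   | tri< a<b _ _ = sym (e-reversed a<b)
  ...   | tri≈ _ a≡b _ = ⊥-elim (a≢b a≡b)
  ...   | tri> _ _ b<a = sym (e-ordered b<a)

  -- every edge variable is idempotent modulo I_𝒢 (the diagonal value is 0)
  e-idempotent : ∀ (a b : Fin n) → Idempotent (e a b)
  e-idempotent a b with <-cmp a b
  ... | tri< _ _ _ = gen (boolG _)
  ... | tri≈ _ _ _ = resp (solve 0 (:0 := :0 :* :0 :- :0) ≋-refl) zer
  ... | tri> _ _ _ = gen (boolG _)

  ∈-inS : ∀ {x} {S : Subset n} → x ∈ S → x ∈L inS S
  ∈-inS {x} {S} x∈S = ∈-filter⁺ (_∈? S) (∈-allFin x) x∈S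

  inS-∈ : ∀ {x} {S : Subset n} → x ∈L inS S → x ∈ S
  inS-∈ {S = S} x∈L = proj₂ (∈-filter⁻ (_∈? S) {xs = allFin n} x∈L)

  outS-∉ : ∀ {x} {S : Subset n} → x ∈L outS S → x ∉ S
  outS-∉ {S = S} x∈L = proj₂ (∈-filter⁻ (λ g → ¬? (g ∈? S)) {xs = allFin n} x∈L)

  module OnlyMissing (u : Fin n) (u∉D : u ∉ D) (only-u : ∀ {x} → x ∉ D → x ≡ u) where

    -- The covering generator of S = D - a has one factor for each of the
    -- two vertices a, u outside S; their sums contain e_{ba} and e_{su},
    -- which fix e_{ab} e_{su}, so both factors cancel.
    edge-times-link : ∀ {a b s} → a ∈ D → b ∈ D → b ≢ a → s ∈ D → s ≢ a → I (e a b ⊗ e s u)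
    edge-times-link {a} {b} {s} a∈D b∈D b≢a s∈D s≢a =
      product-cancel (outS S) (λ x → sumL (inS S) (λ t → e t x)) (e a b ⊗ e s u) cancellable
        (mul (e a b ⊗ e s u) (gen (covG S ∣S∣+1≡∣D∣)))
      where
      S = D - a
      ∣S∣+1≡∣D∣ : ∣ S ∣ +ℕ 1 ≡ ∣ D ∣
      ∣S∣+1≡∣D∣ = trans (ℕP.+-comm ∣ S ∣ 1) (∣p-x∣+1≡∣p∣ a∈D)
      cancellable : ∀ x → x ∈L outS S → Cancellable (e a b ⊗ e s u) (sumL (inS S) (λ t → e t x))
      -- a vertex outside S is either a itself or outside D, i.e. u
      cancellable x x∈outS with ∉-remove D (outS-∉ x∈outS)
      ... | inj₂ refl = sum-cancellable (inS S) (λ t → e t a) (λ t → e-idempotent t a)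
          (∈-inS (x∈p∧x≢y⇒x∈p-y b∈D b≢a))
          (subst (Fixes (e a b ⊗ e s u)) (e-sym a b)
            (fixes-resp (⊗-comm _ _) (fixes-multiple (e s u) (e-idempotent a b))))
      ... | inj₁ x∉D with only-u x∉D
      ...   | refl = sum-cancellable (inS S) (λ t → e t u) (λ t → e-idempotent t u)
          (∈-inS (x∈p∧x≢y⇒x∈p-y s∈D s≢a))
          (fixes-multiple (e a b) (e-idempotent s u))

    -- Every edge variable inside D lies in I_𝒢: by the domination
    -- generator ∏_{d ∈ D} (1 - e_{ud}) of u it suffices that e_{gg'} e_{ud}
    -- vanishes for each d ∈ D, which is edge-times-link with a ∈ {g, g'}
    -- chosen different from d.
    edge-in-ideal : ∀ {g g'} → g ∈ D → g' ∈ D → g ≢ g' → I (e g g')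
    edge-in-ideal {g} {g'} g∈D g'∈D g≢g' =
      annihilate (inS D) (e u) (e g g') kills (mul (e g g') (gen (domG u u∉D)))
      where
      kills : ∀ d → d ∈L inS D → I (e g g' ⊗ e u d)
      kills d d∈L rewrite e-sym u d with d ≟ g
      ... | yes refl = subst (λ y → I (y ⊗ e d u)) (e-sym g' g)
                         (edge-times-link g'∈D g∈D g≢g' (inS-∈ d∈L) g≢g')
      ... | no d≢g = edge-times-link g∈D g'∈D (λ g'≡g → g≢g' (sym g'≡g)) (inS-∈ d∈L) d≢g

-- First half of the lemma.  For n = 0 there are no edges; otherwise
-- |D| = n - 1 leaves exactly one vertex u outside D.
edge-variables-in-ideal : (K : ArchimedeanOrderedField) → let open Poly K in
  (n : ℕ) (D : Subset n) → ∣ D ∣ ≡ n ∸ 1 →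
  (v : EVar n) → proj₁ (proj₁ v) ∈ D → proj₂ (proj₁ v) ∈ D → InIdeal (GenGraph n D) (var v)
edge-variables-in-ideal K zero D _ ((() , _) , _) _ _
edge-variables-in-ideal K (suc m) D ∣D∣≡m ((g , g') , g<g') g∈D g'∈D
  with AlmostFullSubset.missing-exists D ∣D∣≡m
... | u , u∉D = subst (InIdeal (GenGraph (suc m) D)) (e-ordered g<g') (edge-in-ideal g∈D g'∈D (<⇒≢ g<g'))
  where
  open Poly K using (InIdeal; GenGraph)
  open import Data.Fin.Properties using (<⇒≢)
  open import Relation.Binary.PropositionalEquality using (subst)
  open EdgeVariables K D
  open OnlyMissing u u∉D (λ x∉D → AlmostFullSubset.missing-unique D ∣D∣≡m x∉D u∉D)

lemma6p1 : (K : ArchimedeanOrderedField) →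
    let open Poly K in
    (nG : ℕ) (DG : Subset nG) (nH : ℕ) (DH : Subset nH) →
    1 ≤ nH → 1 ≤ ∣ DH ∣ →
    ∣ DG ∣ ≡ nG ∸ 1 → 1 ≤ ∣ DG ∣ →
    ((v : EVar nG) → proj₁ (proj₁ v) ∈ DG → proj₂ (proj₁ v) ∈ DG →
    InIdeal (GenGraph nG DG) (var v))
    × ((p : Expr (EVar nG)) → InIdeal (GenGraph nG DG) p →
    InIdeal (GenViz nG DG nH DH) (rename ιG p))
lemma6p1 K nG DG nH DH _ _ ∣DG∣≡nG∸1 _ =
    edge-variables-in-ideal K nG DG ∣DG∣≡nG∸1
  , λ _ → rename-ideal ιG fromG
  where
  open Poly K using (ιG; fromG)
  open Renaming K using (rename-ideal)
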